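{- Let $\Gamma$ be the random graph with vertex set $\mathbb{N}$, and let $\mathcal{C}_\Gamma$ be the conjugacy equivalence relation on $\operatorname{Aut}\Gamma$, i.e. $f\,\mathcal{C}_\Gamma\, g$ iff there is $h\in\operatorname{Aut}\Gamma$ with $hf=gh$. Let $\mathcal{G}$ be the standard Borel space of graphs with vertex set $\mathbb{N}$ and let $\cong$ be the isomorphism relation on $\mathcal{G}$. Then $\cong$ is Borel reducible to $\mathcal{C}_\Gamma$; that is, there is a Borel map $x\mapsto\phi_x$ from $\mathcal{G}$ to $\operatorname{Aut}\Gamma$ such that for all $x,y\in\mathcal{G}$, $x\cong y$ if and only if $\phi_x$ and $\phi_y$ are conjugate in $\operatorname{Aut}\Gamma$.
   Context: The random graph is the unique (up to isomorphism) countably infinite graph such that for any two finite disjoint sets of vertices $U,V$ there is a vertex adjacent to every member of $U$ and to no member of $V$. The set $\mathcal{G}$ of graphs on $\mathbb{N}$ is identified with the set of edge relations, a Borel subset of $2^{\mathbb{N}\times\mathbb{N}}$, hence a standard Borel space. $\operatorname{Aut}\Gamma$ carries the Polish topology of pointwise convergence (as a closed subgroup of the group of permutations of $\mathbb{N}$, viewed inside $\mathbb{N}^{\mathbb{N}}$) and the associated Borel structure. For equivalence relations $E,F$ on standard Borel spaces $X,Y$, $E$ is Borel reducible to $F$ iff there is a Borel map $f:X\to Y$ with $x\,E\,x' \iff f(x)\,F\,f(x')$ for all $x,x'\in X$. -}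

module Defs where

open import Data.Nat using (ℕ)
open import Data.Bool using (Bool; true; false)
open import Data.List using (List)
open import Data.List.Membership.Propositional using (_∈_; _∉_)
open import Data.List.Relation.Unary.All using (All)
open import Data.Product using (Σ; _×_; ∃)
open import Relation.Nullary using (¬_)
open import Relation.Binary.PropositionalEquality using (_≡_)
open import Function.Bundles using (_⇔_)

-- The ambient space 2^(ℕ×ℕ) of edge relations (curried).
Rel₂ : Set
Rel₂ = ℕ → ℕ → Bool

IsGraph : Rel₂ → Set
IsGraph x = (∀ i → x i i ≡ false) × (∀ i j → x i j ≡ x j i)

ExtensionProperty : Rel₂ → Set
ExtensionProperty Γ =
  (U V : List ℕ) → (∀ {u} → u ∈ U → u ∉ V) →
  ∃ λ z → z ∉ U × z ∉ V × All (λ u → Γ z u ≡ true) U × All (λ v → Γ z v ≡ false) V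

IsRandomGraph : Rel₂ → Set
IsRandomGraph Γ = IsGraph Γ × ExtensionProperty Γ

record Iso (x y : Rel₂) : Set where
  field
    fun     : ℕ → ℕ
    inv     : ℕ → ℕ
    inv-fun : ∀ n → inv (fun n) ≡ n
    fun-inv : ∀ n → fun (inv n) ≡ n
    edges   : ∀ i j → y (fun i) (fun j) ≡ x i j
open Iso public

_≅_ : Rel₂ → Rel₂ → Set
x ≅ y = Iso x y

Aut : Rel₂ → Set
Aut Γ = Iso Γ Γ

Conj : (Γ : Rel₂) → Aut Γ → Aut Γ → Set
Conj Γ f g = Σ (Aut Γ) λ h → ∀ n → fun h (fun f n) ≡ fun g (fun h n)

-- Borel codes for subsets of 2^(ℕ×ℕ): generated by the subbasic clopen
-- sets {x | x i j = true} under complement and countable union.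
data BorelCode : Set where
  basic : ℕ → ℕ → BorelCode
  compl : BorelCode → BorelCode
  union : (ℕ → BorelCode) → BorelCode

⟦_⟧ : BorelCode → Rel₂ → Set
⟦ basic i j ⟧ x = x i j ≡ true
⟦ compl B ⟧ x = ¬ ⟦ B ⟧ x
⟦ union Bs ⟧ x = Σ ℕ λ k → ⟦ Bs k ⟧ x

-- A map φ : 𝒢 → Aut Γ is Borel iff the preimage of each subbasic open set
-- {f | f n = m} of Aut Γ ⊆ ℕ^ℕ is a Borel subset of 𝒢 (relative to 𝒢).
IsBorelMap : (Γ : Rel₂) → ((x : Rel₂) → IsGraph x → Aut Γ) → Set
IsBorelMap Γ φ = ∀ n m → Σ BorelCode λ B →
  ∀ x (gx : IsGraph x) → (fun (φ x gx) n ≡ m) ⇔ ⟦ B ⟧ x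

module Submission where

-- For a graph x on ℕ, finite terms built from the vertices of x and fresh
-- vertices "joined exactly to U" form a countable graph `free x` with the
-- extension property, so an effective back-and-forth gives an isomorphism
-- Γ ≅ free x. Flipping the tag of every fresh vertex is an involutive
-- automorphism τ of free x whose fixed points are exactly the vertices of x;
-- transported to Γ it is φ_x. An isomorphism x ≅ y lifts to the term graphs
-- and conjugates φ_x to φ_y; conversely a conjugacy, transported to the term
-- graphs, commutes with τ and hence maps the vertices of x onto those of y.
-- The k-th stage of the back-and-forth only reads x on k × k, so every set
-- {x | φ_x n = m} is a countable union of clopen sets.

open import Defs
open import Data.Bool using (Bool; true; false; not; _∨_; if_then_else_)
open import Data.Bool.Properties using (∨-comm; ∨-zeroʳ; ∨-inverseʳ; not-involutive; not-¬)
open import Data.Empty using (⊥-elim)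
open import Data.List using (List; []; _∷_; map; _++_; concatMap; upTo; length; cartesianProduct)
open import Data.List.Membership.Propositional using (_∈_; _∉_; find; lose)
open import Data.List.Membership.Propositional.Properties
  using ( ∈-map⁺; ∈-map⁻; ∈-++⁺ˡ; ∈-++⁺ʳ; ∈-++⁻; ∈-concatMap⁺; ∈-concatMap⁻
        ; ∈-cartesianProduct⁺; ∈-upTo⁺; ∈-upTo⁻)
open import Data.List.Relation.Binary.Subset.Propositional using (_⊆_)
open import Data.List.Relation.Unary.All as All using (all?)
open import Data.List.Relation.Unary.Any using (Any; here; there; any?)
open import Data.Nat using (ℕ; zero; suc; _+_; _≤_; _<_; _⊔_; _≟_; z≤n; s≤s; z<s)
open import Data.Nat.Properties
open import Data.Product using (Σ; _×_; _,_; proj₁; proj₂; ∃; swap)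
open import Data.Product.Properties using () renaming (≡-dec to ×-≡-dec)
open import Data.Sum using (_⊎_; inj₁; inj₂)
open import Function using (_∘_; id)
open import Function.Bundles using (_⇔_; mk⇔; Equivalence)
open import Relation.Binary.PropositionalEquality
open import Relation.Nullary using (Dec; yes; no; does; ¬_)
open import Relation.Nullary.Decidable using (dec-true; dec-false; does-⇔; ¬?; _×-dec_)

-- `new U n s` is a fresh vertex joined exactly to U among older terms; the
-- padding n lets it be chosen larger than any finite set, and τ flips s.
data Term : Set where
  vertex : ℕ → Term
  new    : List Term → ℕ → Bool → Term

children : Term → List Term
children (vertex _) = []
children (new U _ _) = U

size : Term → ℕ
sizes : List Term → ℕ
size (vertex _) = 0
size (new U n _) = suc (n + sizes U)
sizes [] = 0
sizes (c ∷ U) = size c + sizes U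

size≤sizes : ∀ {c U} → c ∈ U → size c ≤ sizes U
size≤sizes (here refl) = m≤m+n _ _
size≤sizes {U = d ∷ U} (there c∈U) = ≤-trans (size≤sizes c∈U) (m≤n+m _ (size d))

children-smaller : ∀ {c d} → c ∈ children d → size c < size d
children-smaller {d = new U n _} c∈U = s≤s (≤-trans (size≤sizes c∈U) (m≤n+m (sizes U) n))

new∉children : ∀ {U n s} → new U n s ∉ U
new∉children {U} {n} {s} c∈U = <-irrefl refl (children-smaller {d = new U n s} c∈U)

infix 4 _≟ᵀ_ _≟ᵀˢ_
_≟ᵀ_ : (c d : Term) → Dec (c ≡ d)
_≟ᵀˢ_ : (U V : List Term) → Dec (U ≡ V)
vertex i ≟ᵀ vertex j with i ≟ j
... | yes refl = yes refl
... | no i≢j = no λ { refl → i≢j refl }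
vertex _ ≟ᵀ new _ _ _ = no λ ()
new _ _ _ ≟ᵀ vertex _ = no λ ()
new U n s ≟ᵀ new V m t with U ≟ᵀˢ V | n ≟ m | s Data.Bool.≟ t
... | yes refl | yes refl | yes refl = yes refl
... | no U≢V | _ | _ = no λ { refl → U≢V refl }
... | yes _ | no n≢m | _ = no λ { refl → n≢m refl }
... | yes _ | yes _ | no s≢t = no λ { refl → s≢t refl }
[] ≟ᵀˢ [] = yes refl
[] ≟ᵀˢ _ ∷ _ = no λ ()
_ ∷ _ ≟ᵀˢ [] = no λ ()
c ∷ U ≟ᵀˢ d ∷ V with c ≟ᵀ d | U ≟ᵀˢ V
... | yes refl | yes refl = yes refl
... | no c≢d | _ = no λ { refl → c≢d refl }
... | yes _ | no U≢V = no λ { refl → U≢V refl }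

open import Data.List.Membership.DecPropositional _≟ᵀ_ using (_∈?_)

free : Rel₂ → Term → Term → Bool
free x (vertex i) (vertex j) = x i j
free x c d = does (c ∈? children d) ∨ does (d ∈? children c)

free-sym : ∀ {x} → (∀ i j → x i j ≡ x j i) → ∀ c d → free x c d ≡ free x d c
free-sym sym-x (vertex i) (vertex j) = sym-x i j
free-sym sym-x (vertex i) (new V _ _) = ∨-comm (does (vertex i ∈? V)) false
free-sym sym-x (new U _ _) (vertex j) = ∨-comm false (does (vertex j ∈? U))
free-sym sym-x (new U n s) (new V m t) = ∨-comm (does (new U n s ∈? V)) (does (new V m t ∈? U))

free-irrefl : ∀ {x} → (∀ i → x i i ≡ false) → ∀ c → free x c c ≡ false
free-irrefl irr-x (vertex i) = irr-x i
free-irrefl irr-x (new U n s) rewrite dec-false (new U n s ∈? U) new∉children = refl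

Disjoint : {B : Set} → List B → List B → Set
Disjoint U V = ∀ {u} → u ∈ U → u ∉ V

record IsWitness {B : Set} (EB : B → B → Bool) (U V : List B) (z : B) : Set where
  field
    ∉-joined : z ∉ U
    ∉-apart  : z ∉ V
    joined   : ∀ {u} → u ∈ U → EB z u ≡ true
    apart    : ∀ {v} → v ∈ V → EB z v ≡ false

WitnessFunction : {B : Set} → (B → B → Bool) → (List B → List B → B) → Set
WitnessFunction EB w = ∀ U V → Disjoint U V → IsWitness EB U V (w U V)

freeWitness : List Term → List Term → Term
freeWitness U V = new U (sizes V) false

freeWitness-correct : ∀ x → WitnessFunction (free x) freeWitness
freeWitness-correct x U V U∩V=∅ = record
  { ∉-joined = new∉children
  ; ∉-apart  = λ z∈V → <-irrefl refl (larger z∈V)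
  ; joined   = λ {u} u∈U →
      trans (cong (does (z ∈? children u) ∨_) (dec-true (u ∈? U) u∈U)) (∨-zeroʳ _)
  ; apart    = λ {v} v∈V →
      trans (cong (_∨ does (v ∈? U)) (dec-false (z ∈? children v) (apart-children v∈V)))
            (dec-false (v ∈? U) (λ v∈U → U∩V=∅ v∈U v∈V))
  }
  where
  z = freeWitness U V
  larger : ∀ {v} → v ∈ V → size v < size z
  larger v∈V = s≤s (≤-trans (size≤sizes v∈V) (m≤m+n (sizes V) (sizes U)))
  apart-children : ∀ {v} → v ∈ V → z ∉ children v
  apart-children v∈V z∈v = <-asym (larger v∈V) (children-smaller z∈v)

rename : (ℕ → ℕ) → (Bool → Bool) → Term → Term
renames : (ℕ → ℕ) → (Bool → Bool) → List Term → List Term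
rename β t (vertex i) = vertex (β i)
rename β t (new U n s) = new (renames β t U) n (t s)
renames β t [] = []
renames β t (c ∷ U) = rename β t c ∷ renames β t U

rename-∘ : ∀ β t β' t' c → rename β' t' (rename β t c) ≡ rename (β' ∘ β) (t' ∘ t) c
renames-∘ : ∀ β t β' t' U → renames β' t' (renames β t U) ≡ renames (β' ∘ β) (t' ∘ t) U
rename-∘ β t β' t' (vertex i) = refl
rename-∘ β t β' t' (new U n s) = cong (λ V → new V n (t' (t s))) (renames-∘ β t β' t' U)
renames-∘ β t β' t' [] = refl
renames-∘ β t β' t' (c ∷ U) = cong₂ _∷_ (rename-∘ β t β' t' c) (renames-∘ β t β' t' U)

rename-id : ∀ {β t} → (∀ i → β i ≡ i) → (∀ s → t s ≡ s) → ∀ c → rename β t c ≡ c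
renames-id : ∀ {β t} → (∀ i → β i ≡ i) → (∀ s → t s ≡ s) → ∀ U → renames β t U ≡ U
rename-id β≗id t≗id (vertex i) = cong vertex (β≗id i)
rename-id β≗id t≗id (new U n s) = cong₂ (λ V b → new V n b) (renames-id β≗id t≗id U) (t≗id s)
renames-id β≗id t≗id [] = refl
renames-id β≗id t≗id (c ∷ U) = cong₂ _∷_ (rename-id β≗id t≗id c) (renames-id β≗id t≗id U)

module _ {β β' : ℕ → ℕ} {t t' : Bool → Bool}
         (β'∘β≗id : ∀ i → β' (β i) ≡ i) (t'∘t≗id : ∀ s → t' (t s) ≡ s) where

  rename-cancel : ∀ c → rename β' t' (rename β t c) ≡ c
  rename-cancel c = trans (rename-∘ β t β' t' c) (rename-id β'∘β≗id t'∘t≗id c)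

  rename-injective : ∀ {c d} → rename β t c ≡ rename β t d → c ≡ d
  rename-injective {c} {d} eq =
    trans (sym (rename-cancel c)) (trans (cong (rename β' t') eq) (rename-cancel d))

  ∈-renames : ∀ {c} U → c ∈ U ⇔ rename β t c ∈ renames β t U
  ∈-renames U = mk⇔ to from
    where
    to : ∀ {c U} → c ∈ U → rename β t c ∈ renames β t U
    to (here refl) = here refl
    to (there c∈U) = there (to c∈U)
    from : ∀ {c U} → rename β t c ∈ renames β t U → c ∈ U
    from {U = d ∷ U} (here eq) = here (rename-injective eq)
    from {U = d ∷ U} (there c∈U) = there (from c∈U)

  ∈?-renames : ∀ c U → does (rename β t c ∈? renames β t U) ≡ does (c ∈? U)
  ∈?-renames c U = sym (does-⇔ (∈-renames U) (c ∈? U) (rename β t c ∈? renames β t U))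

  free-rename : ∀ {x y} → (∀ i j → y (β i) (β j) ≡ x i j) →
    ∀ c d → free y (rename β t c) (rename β t d) ≡ free x c d
  free-rename β-edges (vertex i) (vertex j) = β-edges i j
  free-rename β-edges c@(vertex _) (new V _ _) = cong (_∨ false) (∈?-renames c V)
  free-rename β-edges (new U _ _) d@(vertex _) = cong (false ∨_) (∈?-renames d U)
  free-rename β-edges c@(new U _ _) d@(new V _ _) = cong₂ _∨_ (∈?-renames c V) (∈?-renames d U)

τ : Term → Term
τ = rename id not

τ-involutive : ∀ c → τ (τ c) ≡ c
τ-involutive = rename-cancel {β = id} {id} {not} {not} (λ _ → refl) not-involutive

free-τ : ∀ x c d → free x (τ c) (τ d) ≡ free x c d
free-τ x = free-rename {β = id} {id} {not} {not} (λ _ → refl) not-involutive (λ _ _ → refl)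

τ-fixed⇒vertex : ∀ c → τ c ≡ c → ∃ λ i → c ≡ vertex i
τ-fixed⇒vertex (vertex i) _ = i , refl
τ-fixed⇒vertex (new U n s) τc≡c = ⊥-elim (not-¬ refl (sym (cong tag τc≡c)))
  where
  tag : Term → Bool
  tag (vertex _) = s
  tag (new _ _ b) = b

maxVertex : Term → ℕ
maxVertices : List Term → ℕ
maxVertex (vertex i) = i
maxVertex (new U _ _) = maxVertices U
maxVertices [] = 0
maxVertices (c ∷ U) = maxVertex c ⊔ maxVertices U

maxVertices-lub : ∀ {K} U → 0 < K → (∀ {c} → c ∈ U → maxVertex c < K) → maxVertices U < K
maxVertices-lub [] 0<K _ = 0<K
maxVertices-lub (c ∷ U) 0<K U<K = ⊔-lub (U<K (here refl)) (maxVertices-lub U 0<K (U<K ∘ there))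

AgreeBelow : ℕ → Rel₂ → Rel₂ → Set
AgreeBelow K x x' = ∀ i j → i < K → j < K → x i j ≡ x' i j

free-agree : ∀ {K x x'} → AgreeBelow K x x' →
  ∀ c d → maxVertex c < K → maxVertex d < K → free x c d ≡ free x' c d
free-agree x≈x' (vertex i) (vertex j) i<K j<K = x≈x' i j i<K j<K
free-agree x≈x' (vertex i) (new _ _ _) _ _ = refl
free-agree x≈x' (new _ _ _) _ _ _ = refl

IsSimpleGraph : {V : Set} → (V → V → Bool) → Set
IsSimpleGraph E = (∀ v → E v v ≡ false) × (∀ u v → E u v ≡ E v u)

free-isSimpleGraph : ∀ {x} → IsGraph x → IsSimpleGraph (free x)
free-isSimpleGraph (irr-x , sym-x) = free-irrefl irr-x , free-sym sym-x

module _ {A B : Set} (EA : A → A → Bool) (EB : B → B → Bool) where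

  record Coherent (p q : A × B) : Set where
    field
      functional : proj₁ p ≡ proj₁ q → proj₂ p ≡ proj₂ q
      injective  : proj₂ p ≡ proj₂ q → proj₁ p ≡ proj₁ q
      edges      : EA (proj₁ p) (proj₁ q) ≡ EB (proj₂ p) (proj₂ q)

  IsPartialIso : List (A × B) → Set
  IsPartialIso s = ∀ {p q} → p ∈ s → q ∈ s → Coherent p q

  coherent-sym : (∀ a a' → EA a a' ≡ EA a' a) → (∀ b b' → EB b b' ≡ EB b' b) →
    ∀ {p q} → Coherent p q → Coherent q p
  coherent-sym EA-sym EB-sym {a , b} {a' , b'} c = record
    { functional = sym ∘ Coherent.functional c ∘ sym
    ; injective = sym ∘ Coherent.injective c ∘ sym
    ; edges = trans (EA-sym a' a) (trans (Coherent.edges c) (EB-sym b b')) }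

∈-map-swap⁻ : {A B : Set} {p : B × A} {s : List (A × B)} → p ∈ map swap s → swap p ∈ s
∈-map-swap⁻ p∈ with ∈-map⁻ swap p∈
... | _ , q∈s , refl = q∈s

isPartialIso-swap : ∀ {A B EA EB} {s : List (A × B)} →
  IsPartialIso EA EB s → IsPartialIso EB EA (map swap s)
isPartialIso-swap iso p∈ q∈ = record
  { functional = Coherent.injective c ; injective = Coherent.functional c ; edges = sym (Coherent.edges c) }
  where c = iso (∈-map-swap⁻ p∈) (∈-map-swap⁻ q∈)

module _ {A B : Set} (EA : A → A → Bool) where

  partners : A → Bool → List (A × B) → List B
  partners a b [] = []
  partners a b ((a' , b') ∷ s) with EA a a' Data.Bool.≟ b
  ... | yes _ = b' ∷ partners a b s
  ... | no _ = partners a b s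

  partners⁻ : ∀ {a b b'} s → b' ∈ partners a b s → ∃ λ a' → (a' , b') ∈ s × EA a a' ≡ b
  partners⁻ {a} {b} ((a' , _) ∷ s) b'∈ with EA a a' Data.Bool.≟ b
  partners⁻ ((a' , _) ∷ s) (here refl) | yes eq = a' , here refl , eq
  partners⁻ (_ ∷ s) (there b'∈) | yes _ = let a' , p∈ , eq = partners⁻ s b'∈ in a' , there p∈ , eq
  partners⁻ (_ ∷ s) b'∈         | no _  = let a' , p∈ , eq = partners⁻ s b'∈ in a' , there p∈ , eq

  partners⁺ : ∀ {a a' b b'} s → (a' , b') ∈ s → EA a a' ≡ b → b' ∈ partners a b s
  partners⁺ {a} {b = b} ((a₀ , _) ∷ s) p∈ eq with EA a a₀ Data.Bool.≟ b
  partners⁺ (_ ∷ s) (here refl) eq | yes _ = here refl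
  partners⁺ (_ ∷ s) (here refl) eq | no ne = ⊥-elim (ne eq)
  partners⁺ (_ ∷ s) (there p∈) eq | yes _ = there (partners⁺ s p∈ eq)
  partners⁺ (_ ∷ s) (there p∈) eq | no _ = partners⁺ s p∈ eq

partners-cong : ∀ {A B} {EA EA' : A → A → Bool} {a b} (s : List (A × B)) →
  (∀ {q} → q ∈ s → EA a (proj₁ q) ≡ EA' a (proj₁ q)) →
  partners EA a b s ≡ partners EA' a b s
partners-cong [] _ = refl
partners-cong {EA = EA} {EA'} {a} {b} ((a' , b') ∷ s) agree
  with EA a a' Data.Bool.≟ b | EA' a a' Data.Bool.≟ b
... | yes _ | yes _ = cong (b' ∷_) (partners-cong s (agree ∘ there))
... | no _ | no _ = partners-cong s (agree ∘ there)
... | yes eq | no ne = ⊥-elim (ne (trans (sym (agree (here refl))) eq))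
... | no ne | yes eq = ⊥-elim (ne (trans (agree (here refl)) eq))

module _ {A B : Set} (_≟A_ : (a a' : A) → Dec (a ≡ a')) where
  open import Data.List.Membership.DecPropositional _≟A_ using () renaming (_∈?_ to _∈A?_)

  forth : (A → A → Bool) → (List B → List B → B) → A → List (A × B) → List (A × B)
  forth EA w a s with a ∈A? map proj₁ s
  ... | yes _ = s
  ... | no _ = (a , w (partners EA a true s) (partners EA a false s)) ∷ s

  forth-⊇ : ∀ {EA w a s} → s ⊆ forth EA w a s
  forth-⊇ {a = a} {s} p∈ with a ∈A? map proj₁ s
  ... | yes _ = p∈
  ... | no _ = there p∈

  forth-dom : ∀ EA w a s → a ∈ map proj₁ (forth EA w a s)
  forth-dom EA w a s with a ∈A? map proj₁ s
  ... | yes a∈ = a∈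
  ... | no _ = here refl

  ∈-forth⁻ : ∀ {EA w a s p} → p ∈ forth EA w a s →
    p ∈ s ⊎ p ≡ (a , w (partners EA a true s) (partners EA a false s))
  ∈-forth⁻ {a = a} {s} p∈ with a ∈A? map proj₁ s
  ∈-forth⁻ p∈ | yes _ = inj₁ p∈
  ∈-forth⁻ (here refl) | no _ = inj₂ refl
  ∈-forth⁻ (there p∈) | no _ = inj₁ p∈

  forth-cong : ∀ {EA EA' w a} s → (∀ {q} → q ∈ s → EA a (proj₁ q) ≡ EA' a (proj₁ q)) →
    forth EA w a s ≡ forth EA' w a s
  forth-cong {w = w} {a} s agree with a ∈A? map proj₁ s
  ... | yes _ = refl
  ... | no _ = cong (λ b → (a , b) ∷ s) (cong₂ w (partners-cong s agree) (partners-cong s agree))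

  module _ {EA : A → A → Bool} {EB : B → B → Bool} (gA : IsSimpleGraph EA) (gB : IsSimpleGraph EB)
           {w : List B → List B → B} (w-correct : WitnessFunction EB w) where

    partners-disjoint : ∀ {a s} → IsPartialIso EA EB s →
      Disjoint (partners EA a true s) (partners EA a false s)
    partners-disjoint {s = s} iso b∈U b∈V with partners⁻ EA s b∈U | partners⁻ EA s b∈V
    ... | _ , p∈ , eq₁ | _ , q∈ , eq₂ with Coherent.injective (iso p∈ q∈) refl
    ... | refl = not-¬ (trans (sym eq₁) eq₂) refl

    fresh-coherent : ∀ {a s z r} → a ∉ map proj₁ s →
      IsWitness EB (partners EA a true s) (partners EA a false s) z → r ∈ s → Coherent EA EB (a , z) r
    fresh-coherent {a} {s} {z} {a' , b'} a∉ z-wit r∈ with EA a a' in eq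
    ... | true = record
      { functional = λ { refl → ⊥-elim (a∉ (∈-map⁺ proj₁ r∈)) }
      ; injective = λ { refl → ⊥-elim (IsWitness.∉-joined z-wit b'∈) }
      ; edges = trans eq (sym (IsWitness.joined z-wit b'∈)) }
      where b'∈ = partners⁺ EA s r∈ eq
    ... | false = record
      { functional = λ { refl → ⊥-elim (a∉ (∈-map⁺ proj₁ r∈)) }
      ; injective = λ { refl → ⊥-elim (IsWitness.∉-apart z-wit b'∈) }
      ; edges = trans eq (sym (IsWitness.apart z-wit b'∈)) }
      where b'∈ = partners⁺ EA s r∈ eq

    forth-isPartialIso : ∀ {a s} → IsPartialIso EA EB s → IsPartialIso EA EB (forth EA w a s)
    forth-isPartialIso {a} {s} iso with a ∈A? map proj₁ s
    ... | yes _ = iso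
    ... | no a∉ = λ where
        (here refl) (here refl) → record
          { functional = λ _ → refl
          ; injective = λ _ → refl
          ; edges = trans (proj₁ gA a) (sym (proj₁ gB z)) }
        (here refl) (there r∈) → fresh-coherent a∉ z-wit r∈
        (there r∈) (here refl) →
          coherent-sym EA EB (proj₂ gA) (proj₂ gB) (fresh-coherent a∉ z-wit r∈)
        (there p∈) (there q∈) → iso p∈ q∈
      where
      z = w (partners EA a true s) (partners EA a false s)
      z-wit = w-correct _ _ (partners-disjoint iso)

listsUpTo : ∀ {A : Set} → ℕ → List A → List (List A)
listsUpTo zero A = [] ∷ []
listsUpTo (suc k) A = [] ∷ concatMap (λ a → map (a ∷_) (listsUpTo k A)) A

∈-listsUpTo⁺ : ∀ {A : Set} {xs : List A} U k → length U ≤ k → U ⊆ xs → U ∈ listsUpTo k xs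
∈-listsUpTo⁺ [] zero _ _ = here refl
∈-listsUpTo⁺ [] (suc k) _ _ = here refl
∈-listsUpTo⁺ {xs = xs} (c ∷ U) (suc k) (s≤s |U|≤k) U⊆xs =
  there (∈-concatMap⁺ (λ a → map (a ∷_) (listsUpTo k xs))
          (lose (U⊆xs (here refl)) (∈-map⁺ (c ∷_) (∈-listsUpTo⁺ U k |U|≤k (U⊆xs ∘ there)))))

∈-listsUpTo⁻ : ∀ {A : Set} {xs : List A} k {U} → U ∈ listsUpTo k xs → U ⊆ xs
∈-listsUpTo⁻ zero (here refl) ()
∈-listsUpTo⁻ (suc k) (here refl) ()
∈-listsUpTo⁻ {xs = xs} (suc k) (there U∈) u∈U
  with find (∈-concatMap⁻ (λ a → map (a ∷_) (listsUpTo k xs)) {xs = xs} U∈)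
... | a , a∈xs , aU∈ with ∈-map⁻ (a ∷_) aU∈ | u∈U
... | U' , U'∈ , refl | here refl = a∈xs
... | U' , U'∈ , refl | there u∈U' = ∈-listsUpTo⁻ k U'∈ u∈U'

newTermsWith : List Term → ℕ → List Term
newTermsWith U n = map (new U n) (true ∷ false ∷ [])

newTerms : ℕ → List Term → List Term
newTerms k U = concatMap (newTermsWith U) (upTo k)

∈-newTerms⁺ : ∀ {k U n} s → n < k → new U n s ∈ newTerms k U
∈-newTerms⁺ {U = U} {n} s n<k =
  ∈-concatMap⁺ (newTermsWith U) (lose (∈-upTo⁺ n<k) (∈-map⁺ (new U n) (∈-bools s)))
  where
  ∈-bools : ∀ b → b ∈ true ∷ false ∷ []
  ∈-bools true = here refl
  ∈-bools false = there (here refl)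

newTerms-maxVertex : ∀ {k U c} → c ∈ newTerms k U → maxVertex c ≡ maxVertices U
newTerms-maxVertex {k} {U} c∈ with find (∈-concatMap⁻ (newTermsWith U) {xs = upTo k} c∈)
... | n , _ , c∈row with ∈-map⁻ (new U n) c∈row
...   | _ , _ , refl = refl

terms : ℕ → List Term
freshTerms : ℕ → List Term
terms k = map vertex (upTo (suc k)) ++ freshTerms k
freshTerms zero = []
freshTerms (suc k) = concatMap (newTerms (suc k)) (listsUpTo k (terms k))

rank : Term → ℕ
ranks : List Term → ℕ
rank (vertex i) = i
rank (new U n _) = suc (n ⊔ (length U ⊔ ranks U))
ranks [] = 0
ranks (c ∷ U) = rank c ⊔ ranks U

∈-terms : ∀ c k → rank c ≤ k → c ∈ terms k
⊆-terms : ∀ U k → ranks U ≤ k → U ⊆ terms k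
∈-terms (vertex i) k i≤k = ∈-++⁺ˡ (∈-map⁺ vertex (∈-upTo⁺ (s≤s i≤k)))
∈-terms (new U n s) (suc k) (s≤s rank≤k) =
  ∈-++⁺ʳ (map vertex (upTo (suc (suc k))))
    (∈-concatMap⁺ (newTerms (suc k))
      (lose (∈-listsUpTo⁺ U k |U|≤k (⊆-terms U k ranks≤k)) (∈-newTerms⁺ s (s≤s n≤k))))
  where
  n≤k = m⊔n≤o⇒m≤o n _ rank≤k
  |U|≤k = m⊔n≤o⇒m≤o (length U) _ (m⊔n≤o⇒n≤o n _ rank≤k)
  ranks≤k = m⊔n≤o⇒n≤o (length U) _ (m⊔n≤o⇒n≤o n _ rank≤k)
⊆-terms (c ∷ U) k ranks≤k (here refl) = ∈-terms c k (m⊔n≤o⇒m≤o (rank c) _ ranks≤k)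
⊆-terms (c ∷ U) k ranks≤k (there u∈U) = ⊆-terms U k (m⊔n≤o⇒n≤o (rank c) _ ranks≤k) u∈U

terms-bound : ∀ k {c} → c ∈ terms k → maxVertex c < suc k
terms-bound k c∈ with ∈-++⁻ (map vertex (upTo (suc k))) c∈
... | inj₁ c∈vertices with ∈-map⁻ vertex c∈vertices
...   | i , i∈ , refl = ∈-upTo⁻ i∈
terms-bound (suc k) c∈ | inj₂ c∈fresh
  with find (∈-concatMap⁻ (newTerms (suc k)) {xs = listsUpTo k (terms k)} c∈fresh)
... | U , U∈ , c∈new rewrite newTerms-maxVertex {suc k} {U} c∈new =
  m<n⇒m<1+n (maxVertices-lub U z<s (terms-bound k ∘ ∈-listsUpTo⁻ k U∈))

record GraphIso {V W : Set} (E : V → V → Bool) (F : W → W → Bool) : Set where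
  field
    to        : V → W
    from      : W → V
    from∘to   : ∀ v → from (to v) ≡ v
    to∘from   : ∀ w → to (from w) ≡ w
    adjacency : ∀ u v → F (to u) (to v) ≡ E u v

module _ {V W X : Set} {E : V → V → Bool} {F : W → W → Bool} {G : X → X → Bool} where
  open GraphIso

  infixr 9 _∘ᴳ_
  _∘ᴳ_ : GraphIso F G → GraphIso E F → GraphIso E G
  ψ ∘ᴳ χ = record
    { to = to ψ ∘ to χ
    ; from = from χ ∘ from ψ
    ; from∘to = λ v → trans (cong (from χ) (from∘to ψ (to χ v))) (from∘to χ v)
    ; to∘from = λ w → trans (cong (to ψ) (to∘from χ (from ψ w))) (to∘from ψ w)
    ; adjacency = λ u v → trans (adjacency ψ (to χ u) (to χ v)) (adjacency χ u v) }

invᴳ : ∀ {V W} {E : V → V → Bool} {F : W → W → Bool} → GraphIso E F → GraphIso F E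
invᴳ {F = F} ψ = record
  { to = from ; from = to ; from∘to = to∘from ; to∘from = from∘to
  ; adjacency = λ u v →
      trans (sym (adjacency (from u) (from v))) (cong₂ F (to∘from u) (to∘from v)) }
  where open GraphIso ψ

fromIso : ∀ {x y} → x ≅ y → GraphIso x y
fromIso π = record
  { to = fun π ; from = inv π ; from∘to = inv-fun π ; to∘from = fun-inv π ; adjacency = edges π }

toIso : ∀ {x y} → GraphIso x y → x ≅ y
toIso ψ = record
  { fun = to ; inv = from ; inv-fun = from∘to ; fun-inv = to∘from ; edges = adjacency }
  where open GraphIso ψ

τ-iso : ∀ x → GraphIso (free x) (free x)
τ-iso x = record
  { to = τ ; from = τ ; from∘to = τ-involutive ; to∘from = τ-involutive ; adjacency = free-τ x }

rename-iso : ∀ {x y} → x ≅ y → GraphIso (free x) (free y)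
rename-iso π = record
  { to = rename (fun π) id
  ; from = rename (inv π) id
  ; from∘to = rename-cancel (inv-fun π) (λ _ → refl)
  ; to∘from = rename-cancel (fun-inv π) (λ _ → refl)
  ; adjacency = free-rename {fun π} {inv π} {id} {id} (inv-fun π) (λ _ → refl) (edges π) }

rename-τ : ∀ β c → rename β id (τ c) ≡ τ (rename β id c)
rename-τ β c = trans (rename-∘ id not β id c) (sym (rename-∘ β id id not c))

τ-Equivariant : (Term → Term) → Set
τ-Equivariant h = ∀ c → h (τ c) ≡ τ (h c)

vertex-injective : ∀ {i j} → vertex i ≡ vertex j → i ≡ j
vertex-injective refl = refl

module _ (h : Term → Term) (hτ : τ-Equivariant h) where

  vertexIndex : ℕ → ℕ
  vertexIndex i = proj₁ (τ-fixed⇒vertex (h (vertex i)) (sym (hτ (vertex i))))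

  vertexIndex-≡ : ∀ i → h (vertex i) ≡ vertex (vertexIndex i)
  vertexIndex-≡ i = proj₂ (τ-fixed⇒vertex (h (vertex i)) (sym (hτ (vertex i))))

vertexIndex-inverse : ∀ {h h'} hτ h'τ → (∀ c → h' (h c) ≡ c) →
  ∀ i → vertexIndex h' h'τ (vertexIndex h hτ i) ≡ i
vertexIndex-inverse {h} {h'} hτ h'τ h'∘h i = vertex-injective (begin
  vertex (vertexIndex h' h'τ (vertexIndex h hτ i))  ≡⟨ sym (vertexIndex-≡ h' h'τ _) ⟩
  h' (vertex (vertexIndex h hτ i))                  ≡⟨ cong h' (sym (vertexIndex-≡ h hτ i)) ⟩
  h' (h (vertex i))                                 ≡⟨ h'∘h (vertex i) ⟩
  vertex i                                          ∎)
  where open ≡-Reasoning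

invᴳ-τ-Equivariant : ∀ {x y} (ψ : GraphIso (free x) (free y)) →
  τ-Equivariant (GraphIso.to ψ) → τ-Equivariant (GraphIso.from ψ)
invᴳ-τ-Equivariant ψ ψτ c = begin
  from (τ c)              ≡⟨ cong (from ∘ τ) (sym (to∘from c)) ⟩
  from (τ (to (from c)))  ≡⟨ cong from (sym (ψτ (from c))) ⟩
  from (to (τ (from c)))  ≡⟨ from∘to (τ (from c)) ⟩
  τ (from c)              ∎
  where
  open GraphIso ψ
  open ≡-Reasoning

τ-Equivariant⇒≅ : ∀ {x y} (ψ : GraphIso (free x) (free y)) →
  τ-Equivariant (GraphIso.to ψ) → x ≅ y
τ-Equivariant⇒≅ {x} {y} ψ ψτ = record
  { fun = vertexIndex to ψτ
  ; inv = vertexIndex from ψ⁻¹τ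
  ; inv-fun = vertexIndex-inverse ψτ ψ⁻¹τ from∘to
  ; fun-inv = vertexIndex-inverse ψ⁻¹τ ψτ to∘from
  ; edges = λ i j → trans (sym (cong₂ (free y) (vertexIndex-≡ to ψτ i) (vertexIndex-≡ to ψτ j)))
                          (adjacency (vertex i) (vertex j)) }
  where
  open GraphIso ψ
  ψ⁻¹τ = invᴳ-τ-Equivariant ψ ψτ

Represents : BorelCode → (Rel₂ → Bool) → Set
Represents B P = ∀ x → ⟦ B ⟧ x ⇔ P x ≡ true

represents-cong : ∀ {B P Q} → (∀ x → P x ≡ Q x) → Represents B P → Represents B Q
represents-cong P≗Q B~P x = mk⇔ (λ x∈B → trans (sym (P≗Q x)) (Equivalence.to (B~P x) x∈B))
                                (λ Qx → Equivalence.from (B~P x) (trans (P≗Q x) Qx))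

basic-represents : ∀ i j → Represents (basic i j) (λ x → x i j)
basic-represents i j x = mk⇔ id id

compl-represents : ∀ {B P} → Represents B P → Represents (compl B) (not ∘ P)
compl-represents {P = P} B~P x = mk⇔ to from
  where
  to : ¬ ⟦ _ ⟧ x → not (P x) ≡ true
  to x∉B with P x in eq
  ... | true = ⊥-elim (x∉B (Equivalence.from (B~P x) eq))
  ... | false = refl
  from : not (P x) ≡ true → ¬ ⟦ _ ⟧ x
  from notPx x∈B = not-¬ refl (trans (Equivalence.to (B~P x) x∈B) (sym notPx))

infixr 6 _∪ᶜ_
_∪ᶜ_ : BorelCode → BorelCode → BorelCode
B ∪ᶜ C = union λ { zero → B ; (suc _) → C }

∪-represents : ∀ {B C P Q} → Represents B P → Represents C Q →
  Represents (B ∪ᶜ C) (λ x → P x ∨ Q x)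
∪-represents {P = P} {Q} B~P C~Q x = mk⇔ to from
  where
  to : ⟦ _ ∪ᶜ _ ⟧ x → P x ∨ Q x ≡ true
  to (zero , x∈B) rewrite Equivalence.to (B~P x) x∈B = refl
  to (suc _ , x∈C) rewrite Equivalence.to (C~Q x) x∈C = ∨-zeroʳ (P x)
  from : P x ∨ Q x ≡ true → ⟦ _ ∪ᶜ _ ⟧ x
  from Px∨Qx with P x in eq
  ... | true = zero , Equivalence.from (B~P x) eq
  ... | false = 1 , Equivalence.from (C~Q x) Px∨Qx

constant : Bool → BorelCode
constant true = basic 0 0 ∪ᶜ compl (basic 0 0)
constant false = compl (constant true)

constant-represents : ∀ b → Represents (constant b) (λ _ → b)
constant-represents true =
  represents-cong (λ x → ∨-inverseʳ (x 0 0))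
    (∪-represents (basic-represents 0 0) (compl-represents (basic-represents 0 0)))
constant-represents false = compl-represents (constant-represents true)

choose : BorelCode → BorelCode → BorelCode → BorelCode
choose A B C = compl (compl A ∪ᶜ compl B) ∪ᶜ compl (A ∪ᶜ compl C)

choose-represents : ∀ {A B C P Q R} → Represents A P → Represents B Q → Represents C R →
  Represents (choose A B C) (λ x → if P x then Q x else R x)
choose-represents {P = P} {Q} {R} A~P B~Q C~R = represents-cong (λ x → if-as-∨ (P x) (Q x) (R x))
  (∪-represents (compl-represents (∪-represents (compl-represents A~P) (compl-represents B~Q)))
                (compl-represents (∪-represents A~P (compl-represents C~R))))
  where
  if-as-∨ : ∀ a b c → not (not a ∨ not b) ∨ not (a ∨ not c) ≡ (if a then b else c)
  if-as-∨ true true _ = refl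
  if-as-∨ true false _ = refl
  if-as-∨ false _ true = refl
  if-as-∨ false _ false = refl

_≟²_ : (p q : ℕ × ℕ) → Dec (p ≡ q)
_≟²_ = ×-≡-dec _≟_ _≟_

update : ℕ → ℕ → Bool → Rel₂ → Rel₂
update i j b x i' j' = if does ((i' , j') ≟² (i , j)) then b else x i' j'

update-redundant : ∀ {i j b x} → x i j ≡ b → ∀ i' j' → update i j b x i' j' ≡ x i' j'
update-redundant {i} {j} {b} {x} xij≡b i' j' with (i' , j') ≟² (i , j)
... | yes refl = sym xij≡b
... | no _ = refl

AgreeOn : List (ℕ × ℕ) → Rel₂ → Rel₂ → Set
AgreeOn ps x x' = ∀ {i j} → (i , j) ∈ ps → x i j ≡ x' i j

update-agree : ∀ {ps i j b x x'} → AgreeOn ps x x' →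
  AgreeOn ((i , j) ∷ ps) (update i j b x) (update i j b x')
update-agree {i = i} {j} x≈x' {i'} {j'} p∈ with (i' , j') ≟² (i , j) | p∈
... | yes _ | _ = refl
... | no ne | here refl = ⊥-elim (ne refl)
... | no _ | there p∈ps = x≈x' p∈ps

DependsOnlyOn : List (ℕ × ℕ) → (Rel₂ → Bool) → Set
DependsOnlyOn ps P = ∀ x x' → AgreeOn ps x x' → P x ≡ P x'

decisionTree : List (ℕ × ℕ) → (Rel₂ → Bool) → BorelCode
decisionTree [] P = constant (P (λ _ _ → false))
decisionTree ((i , j) ∷ ps) P =
  choose (basic i j) (decisionTree ps (P ∘ update i j true)) (decisionTree ps (P ∘ update i j false))

decisionTree-represents : ∀ ps P → DependsOnlyOn ps P → Represents (decisionTree ps P) P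
decisionTree-represents [] P P-local =
  represents-cong (λ x → P-local _ x λ ()) (constant-represents (P (λ _ _ → false)))
decisionTree-represents ((i , j) ∷ ps) P P-local =
  represents-cong branch (choose-represents (basic-represents i j) (subtree true) (subtree false))
  where
  subtree : ∀ b → Represents (decisionTree ps (P ∘ update i j b)) (P ∘ update i j b)
  subtree b = decisionTree-represents ps (P ∘ update i j b) λ x x' x≈x' →
    P-local (update i j b x) (update i j b x') (update-agree {ps} {i} {j} {b} {x} {x'} x≈x')
  unchanged : ∀ {b} x → x i j ≡ b → P (update i j b x) ≡ P x
  unchanged x xij≡b = P-local _ _ λ {i'} {j'} _ → update-redundant xij≡b i' j'
  branch : ∀ x → (if x i j then P (update i j true x) else P (update i j false x)) ≡ P x
  branch x with x i j in eq
  ... | true = unchanged x eq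
  ... | false = unchanged x eq

square : ℕ → List (ℕ × ℕ)
square K = cartesianProduct (upTo K) (upTo K)

represented-if-dependsBelow : ∀ K P → (∀ x x' → AgreeBelow K x x' → P x ≡ P x') →
  Represents (decisionTree (square K) P) P
represented-if-dependsBelow K P P-local = decisionTree-represents (square K) P λ x x' x≈x' →
  P-local x x' λ i j i<K j<K → x≈x' (∈-cartesianProduct⁺ (∈-upTo⁺ i<K) (∈-upTo⁺ j<K))

module _ {Γ : Rel₂} (ext : ExtensionProperty Γ) where
  open import Data.List.Membership.DecPropositional _≟_ using () renaming (_∈?_ to _∈ℕ?_)

  randomWitness : List ℕ → List ℕ → ℕ
  randomWitness U V with all? (λ u → ¬? (u ∈ℕ? V)) U
  ... | yes U∩V=∅ = proj₁ (ext U V (All.lookup U∩V=∅))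
  ... | no _ = 0 -- never used: forth only asks for witnesses of disjoint lists

  randomWitness-correct : WitnessFunction Γ randomWitness
  randomWitness-correct U V U∩V=∅ with all? (λ u → ¬? (u ∈ℕ? V)) U
  ... | no U∩V≠∅ = ⊥-elim (U∩V≠∅ (All.tabulate U∩V=∅))
  ... | yes U∩V=∅′ with ext U V (All.lookup U∩V=∅′)
  ...   | _ , z∉U , z∉V , joined , apart = record
    { ∉-joined = z∉U ; ∉-apart = z∉V ; joined = All.lookup joined ; apart = All.lookup apart }

does-true⁻ : ∀ {A : Set} (a? : Dec A) → does a? ≡ true → A
does-true⁻ (yes a) _ = a

module Stages {Γ : Rel₂} (Γ-graph : IsSimpleGraph Γ)
              {wΓ : List ℕ → List ℕ → ℕ} (wΓ-correct : WitnessFunction Γ wΓ) where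

  Stage : Set
  Stage = List (ℕ × Term)

  back : Rel₂ → Term → Stage → Stage
  back x c s = map swap (forth _≟ᵀ_ (free x) wΓ c (map swap s))

  backAll : Rel₂ → List Term → Stage → Stage
  backAll x [] s = s
  backAll x (c ∷ cs) s = backAll x cs (back x c s)

  forthStep : ℕ → Stage → Stage
  forthStep = forth _≟_ Γ freeWitness

  stage : Rel₂ → ℕ → Stage
  stage x zero = []
  stage x (suc k) = backAll x (terms k) (forthStep k (stage x k))

  back-⊇ : ∀ {x c s} → s ⊆ back x c s
  back-⊇ p∈ = ∈-map⁺ swap (forth-⊇ _≟ᵀ_ (∈-map⁺ swap p∈))

  backAll-⊇ : ∀ {x} cs {s} → s ⊆ backAll x cs s
  backAll-⊇ [] = id
  backAll-⊇ (c ∷ cs) = backAll-⊇ cs ∘ back-⊇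

  stage-⊆-suc : ∀ {x} k → stage x k ⊆ stage x (suc k)
  stage-⊆-suc k = backAll-⊇ (terms k) ∘ forth-⊇ _≟_

  stage-mono : ∀ {x k k'} → k ≤ k' → stage x k ⊆ stage x k'
  stage-mono {k' = zero} z≤n = id
  stage-mono {k = k} {suc k'} k≤k' with m≤n⇒m<n∨m≡n k≤k'
  ... | inj₁ (s≤s k≤k'') = stage-⊆-suc k' ∘ stage-mono k≤k''
  ... | inj₂ refl = id

  back-ran : ∀ x c s → ∃ λ a → (a , c) ∈ back x c s
  back-ran x c s with ∈-map⁻ proj₁ (forth-dom _≟ᵀ_ (free x) wΓ c (map swap s))
  ... | (_ , a) , p∈ , refl = a , ∈-map⁺ swap p∈

  backAll-ran : ∀ x {c} cs s → c ∈ cs → ∃ λ a → (a , c) ∈ backAll x cs s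
  backAll-ran x (c ∷ cs) s (here refl) = let a , p∈ = back-ran x c s in a , backAll-⊇ cs p∈
  backAll-ran x (_ ∷ cs) s (there c∈cs) = backAll-ran x cs _ c∈cs

  stage-dom : ∀ x k → ∃ λ c → (k , c) ∈ stage x (suc k)
  stage-dom x k with ∈-map⁻ proj₁ (forth-dom _≟_ Γ freeWitness k (stage x k))
  ... | (_ , c) , p∈ , refl = c , backAll-⊇ (terms k) p∈

  stage-ran : ∀ x c → ∃ λ a → (a , c) ∈ stage x (suc (rank c))
  stage-ran x c = backAll-ran x (terms k) (forthStep k (stage x k)) (∈-terms c k ≤-refl)
    where k = rank c

  -- Abstract only so that typechecking equations about φ never unfolds the stages.
  abstract
    toTerm : Rel₂ → ℕ → Term
    toTerm x = proj₁ ∘ stage-dom x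

    fromTerm : Rel₂ → Term → ℕ
    fromTerm x = proj₁ ∘ stage-ran x

    toTerm∈stage : ∀ x a → (a , toTerm x a) ∈ stage x (suc a)
    toTerm∈stage x = proj₂ ∘ stage-dom x

    fromTerm∈stage : ∀ x c → (fromTerm x c , c) ∈ stage x (suc (rank c))
    fromTerm∈stage x = proj₂ ∘ stage-ran x

  module _ {x : Rel₂} (gx : IsGraph x) where

    back-isPartialIso : ∀ {c s} → IsPartialIso Γ (free x) s → IsPartialIso Γ (free x) (back x c s)
    back-isPartialIso iso = isPartialIso-swap
      (forth-isPartialIso _≟ᵀ_ (free-isSimpleGraph gx) Γ-graph wΓ-correct (isPartialIso-swap iso))

    backAll-isPartialIso : ∀ cs {s} → IsPartialIso Γ (free x) s →
      IsPartialIso Γ (free x) (backAll x cs s)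
    backAll-isPartialIso [] iso = iso
    backAll-isPartialIso (c ∷ cs) iso = backAll-isPartialIso cs (back-isPartialIso iso)

    stage-isPartialIso : ∀ k → IsPartialIso Γ (free x) (stage x k)
    stage-isPartialIso zero ()
    stage-isPartialIso (suc k) = backAll-isPartialIso (terms k)
      (forth-isPartialIso _≟_ Γ-graph (free-isSimpleGraph gx) (freeWitness-correct x)
        (stage-isPartialIso k))

    stage-coherent : ∀ k k' {p q} → p ∈ stage x k → q ∈ stage x k' → Coherent Γ (free x) p q
    stage-coherent k k' p∈ q∈ =
      stage-isPartialIso (k ⊔ k') (stage-mono (m≤m⊔n k k') p∈) (stage-mono (m≤n⊔m k k') q∈)

    toFree : GraphIso Γ (free x)
    toFree = record
      { to = toTerm x
      ; from = fromTerm x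
      ; from∘to = λ a → Coherent.injective (stage-coherent (suc (rank (toTerm x a))) (suc a)
          (fromTerm∈stage x (toTerm x a)) (toTerm∈stage x a)) refl
      ; to∘from = λ c → Coherent.functional (stage-coherent (suc (fromTerm x c)) (suc (rank c))
          (toTerm∈stage x (fromTerm x c)) (fromTerm∈stage x c)) refl
      ; adjacency = λ a a' → sym (Coherent.edges
          (stage-coherent (suc a) (suc a') (toTerm∈stage x a) (toTerm∈stage x a'))) }

  φ : (x : Rel₂) → IsGraph x → Aut Γ
  φ x gx = toIso (invᴳ (toFree gx) ∘ᴳ τ-iso x ∘ᴳ toFree gx)

  module _ {x y : Rel₂} (gx : IsGraph x) (gy : IsGraph y) where
    open GraphIso
    open ≡-Reasoning

    ≅⇒conj : x ≅ y → Conj Γ (φ x gx) (φ y gy)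
    ≅⇒conj π = toIso χ , commutes
      where
      χ = invᴳ (toFree gy) ∘ᴳ rename-iso π ∘ᴳ toFree gx
      lift = rename (fun π) id
      commutes : ∀ n → fun (toIso χ) (fun (φ x gx) n) ≡ fun (φ y gy) (fun (toIso χ) n)
      commutes n = begin
        from (toFree gy) (lift (to (toFree gx) (from (toFree gx) (τ c))))
          ≡⟨ cong (from (toFree gy) ∘ lift) (to∘from (toFree gx) (τ c)) ⟩
        from (toFree gy) (lift (τ c))
          ≡⟨ cong (from (toFree gy)) (rename-τ (fun π) c) ⟩
        from (toFree gy) (τ (lift c))
          ≡⟨ cong (from (toFree gy) ∘ τ) (sym (to∘from (toFree gy) (lift c))) ⟩
        from (toFree gy) (τ (to (toFree gy) (from (toFree gy) (lift c))))
          ∎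
        where c = to (toFree gx) n

    conj⇒≅ : Conj Γ (φ x gx) (φ y gy) → x ≅ y
    conj⇒≅ (h , commutes) = τ-Equivariant⇒≅ ψ ψτ
      where
      ψ = toFree gy ∘ᴳ fromIso h ∘ᴳ invᴳ (toFree gx)
      ψτ : τ-Equivariant (to ψ)
      ψτ c = begin
        to (toFree gy) (fun h (from (toFree gx) (τ c)))
          ≡⟨ cong (to (toFree gy) ∘ fun h ∘ from (toFree gx) ∘ τ)
                  (sym (to∘from (toFree gx) c)) ⟩
        to (toFree gy) (fun h (fun (φ x gx) m))
          ≡⟨ cong (to (toFree gy)) (commutes m) ⟩
        to (toFree gy) (from (toFree gy) (τ (to (toFree gy) (fun h m))))
          ≡⟨ to∘from (toFree gy) _ ⟩
        τ (to (toFree gy) (fun h m))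
          ∎
        where m = from (toFree gx) c

  VerticesBelow : ℕ → Stage → Set
  VerticesBelow K s = ∀ {p} → p ∈ s → maxVertex (proj₂ p) < K

  ∈-back⁻ : ∀ {x c s p} → p ∈ back x c s → p ∈ s ⊎ proj₂ p ≡ c
  ∈-back⁻ p∈ with ∈-forth⁻ _≟ᵀ_ (∈-map-swap⁻ p∈)
  ... | inj₁ q∈ = inj₁ (∈-map-swap⁻ q∈)
  ... | inj₂ eq = inj₂ (cong proj₁ eq)

  back-below : ∀ {K x c s} → VerticesBelow K s → maxVertex c < K → VerticesBelow K (back x c s)
  back-below {x = x} s<K c<K p∈ with ∈-back⁻ {x} p∈
  ... | inj₁ q∈ = s<K q∈
  ... | inj₂ refl = c<K

  backAll-below : ∀ {K x} cs {s} → VerticesBelow K s → (∀ {c} → c ∈ cs → maxVertex c < K) →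
    VerticesBelow K (backAll x cs s)
  backAll-below [] s<K _ = s<K
  backAll-below (c ∷ cs) s<K cs<K =
    backAll-below cs (back-below s<K (cs<K (here refl))) (cs<K ∘ there)

  forth-below : ∀ {k s} → VerticesBelow k s → VerticesBelow (suc k) (forthStep k s)
  forth-below {k} {s} s<k p∈ with ∈-forth⁻ _≟_ p∈
  ... | inj₁ q∈ = m<n⇒m<1+n (s<k q∈)
  ... | inj₂ refl = maxVertices-lub _ z<s (λ u∈ → m<n⇒m<1+n (partner<k u∈))
    where
    partner<k : ∀ {u} → u ∈ partners Γ k true s → maxVertex u < k
    partner<k u∈ = let _ , q∈ , _ = partners⁻ Γ s u∈ in s<k q∈

  stage-below : ∀ x k → VerticesBelow k (stage x k)
  stage-below x zero ()
  stage-below x (suc k) = backAll-below (terms k) (forth-below (stage-below x k)) (terms-bound k)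

  backAll-cong : ∀ {K x x'} → AgreeBelow K x x' → ∀ cs {s} → VerticesBelow K s →
    (∀ {c} → c ∈ cs → maxVertex c < K) → backAll x cs s ≡ backAll x' cs s
  backAll-cong x≈x' [] _ _ = refl
  backAll-cong {K} {x} {x'} x≈x' (c ∷ cs) {s} s<K cs<K =
    trans (cong (backAll x cs) back≡) (backAll-cong x≈x' cs (back-below s<K c<K) (cs<K ∘ there))
    where
    c<K = cs<K (here refl)
    back≡ : back x c s ≡ back x' c s
    back≡ = cong (map swap) (forth-cong _≟ᵀ_ (map swap s) λ q∈ →
      free-agree x≈x' c _ c<K (s<K (∈-map-swap⁻ q∈)))

  stage-cong : ∀ {k x x'} → AgreeBelow k x x' → stage x k ≡ stage x' k
  stage-cong {zero} _ = refl
  stage-cong {suc k} {x} {x'} x≈x' = begin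
    backAll x (terms k) (forthStep k (stage x k))
      ≡⟨ cong (backAll x (terms k) ∘ forthStep k) (stage-cong restricted) ⟩
    backAll x (terms k) (forthStep k (stage x' k))
      ≡⟨ backAll-cong x≈x' (terms k) (forth-below (stage-below x' k)) (terms-bound k) ⟩
    backAll x' (terms k) (forthStep k (stage x' k))
      ∎
    where
    open ≡-Reasoning
    restricted : AgreeBelow k x x'
    restricted i j i<k j<k = x≈x' i j (m<n⇒m<1+n i<k) (m<n⇒m<1+n j<k)

  open import Data.List.Membership.DecPropositional (×-≡-dec _≟_ _≟ᵀ_)
    using () renaming (_∈?_ to _∈ˢ?_)

  Records : ℕ → ℕ → Stage → Set
  Records n m s = Any (λ p → n ≡ proj₁ p × (m , τ (proj₂ p)) ∈ s) s

  records? : ∀ n m s → Dec (Records n m s)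
  records? n m s = any? (λ p → (n ≟ proj₁ p) ×-dec ((m , τ (proj₂ p)) ∈ˢ? s)) s

  records : ℕ → ℕ → Stage → Bool
  records n m s = does (records? n m s)

  module _ {x : Rel₂} (gx : IsGraph x) where
    open GraphIso (toFree gx)

    records-sound : ∀ {n m k} → records n m (stage x k) ≡ true → fun (φ x gx) n ≡ m
    records-sound {n} {m} {k} rec with find (does-true⁻ (records? n m (stage x k)) rec)
    ... | (_ , c) , nc∈ , refl , mτc∈ = begin
      from (τ (to n))  ≡⟨ cong (from ∘ τ) (Coherent.functional pairs-at-n refl) ⟩
      from (τ c)       ≡⟨ Coherent.injective pairs-at-τc refl ⟩
      m                ∎
      where
      open ≡-Reasoning
      pairs-at-n = stage-coherent gx (suc n) k (toTerm∈stage x n) nc∈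
      pairs-at-τc = stage-coherent gx (suc (rank (τ c))) k (fromTerm∈stage x (τ c)) mτc∈

    records-complete : ∀ n → ∃ λ k → records n (fun (φ x gx) n) (stage x k) ≡ true
    records-complete n = K , dec-true (records? n _ (stage x K)) (lose n↦c (refl , m↦τc))
      where
      k₁ = suc n
      k₂ = suc (rank (τ (to n)))
      K = k₁ ⊔ k₂
      n↦c : (n , to n) ∈ stage x K
      n↦c = stage-mono {k = k₁} {K} (m≤m⊔n k₁ k₂) (toTerm∈stage x n)
      m↦τc : (from (τ (to n)) , τ (to n)) ∈ stage x K
      m↦τc = stage-mono {k = k₂} {K} (m≤n⊔m k₁ k₂) (fromTerm∈stage x (τ (to n)))

  recordsAt : ℕ → ℕ → ℕ → Rel₂ → Bool
  recordsAt n m k x = records n m (stage x k)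

  recordsAt-represented : ∀ n m k →
    Represents (decisionTree (square k) (recordsAt n m k)) (recordsAt n m k)
  recordsAt-represented n m k =
    represented-if-dependsBelow k (recordsAt n m k) λ _ _ x≈x' → cong (records n m) (stage-cong x≈x')

  φ-borel : IsBorelMap Γ φ
  φ-borel n m = union (λ k → decisionTree (square k) (recordsAt n m k)) , λ x gx → mk⇔
    (λ { refl → let k , rec = records-complete gx n in
                k , Equivalence.from (recordsAt-represented n m k x) rec })
    (λ (k , x∈) → records-sound gx {n} {m} {k} (Equivalence.to (recordsAt-represented n m k x) x∈))

theorem3p2 : (Γ : Rel₂) → IsRandomGraph Γ →
    Σ ((x : Rel₂) → IsGraph x → Aut Γ) λ φ →
      IsBorelMap Γ φ ×
      (∀ x y (gx : IsGraph x) (gy : IsGraph y) → (x ≅ y) ⇔ Conj Γ (φ x gx) (φ y gy))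
theorem3p2 Γ (Γ-graph , ext) =
  φ , φ-borel , λ x y gx gy → mk⇔ (≅⇒conj gx gy) (conj⇒≅ gx gy)
  where open Stages Γ-graph (randomWitness-correct ext)
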